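{- Let $b$ be an odd prime. Then there exists a positive integer $n$ such that $n+j(b-1)$ is $b$-anti-Niven for all $0\leq j\leq 2b$; that is, the maximum length of a $b$-anti-Niven arithmetic progression with common difference $b-1$ is at least $2b+1$.
   Context: For a positive integer $n$ with base-$b$ expansion $n=\sum_{j=0}^m a_jb^j$ ($0\leq a_j\leq b-1$), $s_b(n)=\sum_{j=0}^m a_j$. A positive integer $n$ is $b$-anti-Niven if $\gcd(n,s_b(n))=1$. -}

module Defs where

open import Data.Nat using (ℕ; zero; suc; _+_; _*_; _∸_; _<_; _≤_; NonZero)
open import Data.Nat.DivMod using (_/_; _%_)
open import Data.Nat.GCD using (gcd)
open import Relation.Binary.PropositionalEquality using (_≡_)
open import Data.Product using (_×_)

-- Sum of base-b digits of n, computed with a fuel counter.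
-- With fuel ≥ n (and b ≥ 2) the fuel never runs out before n reaches 0,
-- since n / b < n for n ≥ 1; we always supply fuel = n.
digitSumAux : (b : ℕ) → .{{_ : NonZero b}} → ℕ → ℕ → ℕ
digitSumAux b zero    n = 0
digitSumAux b (suc k) zero = 0
digitSumAux b (suc k) n@(suc _) = n % b + digitSumAux b k (n / b)

s : (b : ℕ) → .{{_ : NonZero b}} → ℕ → ℕ
s b n = digitSumAux b n n

AntiNiven : (b : ℕ) → .{{_ : NonZero b}} → ℕ → Set
AntiNiven b n = 0 < n × gcd n (s b n) ≡ 1

{-# OPTIONS --safe #-}
module Submission where

-- Start at n = 1.  The terms 1 + j (b - 1) have explicit base-b expansions:
-- 1, b and b² for j = 0, 1, b + 1 (digit sum 1); (j - 1) b + (b + 1 - j) for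
-- 2 ≤ j ≤ b, and b² + (j - b - 2) b + (2b + 1 - j) for b + 2 ≤ j ≤ 2b.
-- In the last two cases the digit sum is b and the last digit is nonzero, so
-- the term is coprime to the prime b.

open import Defs
open import Data.Nat
open import Data.Nat.Properties
open import Data.Nat.DivMod
open import Data.Nat.Divisibility
open import Data.Nat.GCD
open import Data.Nat.Primality
open import Data.Nat.Tactic.RingSolver
open import Data.Product
open import Data.Sum
open import Data.Empty
open import Relation.Nullary
open import Relation.Binary.PropositionalEquality

module DigitSum (b : ℕ) .{{_ : NonZero b}} (1<b : 1 < b) where

  [1+n]/b≤n : ∀ n → suc n / b ≤ n
  [1+n]/b≤n n = <⇒≤pred (m/n<m (suc n) b 1<b)

  digitSumAux-fuel : ∀ f g n → n ≤ f → n ≤ g → digitSumAux b f n ≡ digitSumAux b g n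
  digitSumAux-fuel zero    zero    zero    _       _       = refl
  digitSumAux-fuel zero    (suc g) zero    _       _       = refl
  digitSumAux-fuel (suc f) zero    zero    _       _       = refl
  digitSumAux-fuel (suc f) (suc g) zero    _       _       = refl
  digitSumAux-fuel (suc f) (suc g) (suc n) (s≤s p) (s≤s q) =
    cong (suc n % b +_)
      (digitSumAux-fuel f g (suc n / b) (≤-trans ([1+n]/b≤n n) p) (≤-trans ([1+n]/b≤n n) q))

  s-unfold : ∀ m → s b m ≡ m % b + digitSumAux b (pred m) (m / b)
  s-unfold zero    = sym (cong (_+ 0) (m*n%n≡0 0 b))
  s-unfold (suc m) = refl

  n/b≤pred-n : ∀ m → m / b ≤ pred m
  n/b≤pred-n zero    = ≤-reflexive (0/n≡0 b)
  n/b≤pred-n (suc m) = [1+n]/b≤n m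

  [d+q*b]/b≡q : ∀ d q → d < b → (d + q * b) / b ≡ q
  [d+q*b]/b≡q d q d<b = begin
      (d + q * b) / b   ≡⟨ +-distrib-/ d (q * b) remainders<b ⟩
      d / b + q * b / b ≡⟨ cong₂ _+_ (m<n⇒m/n≡0 d<b) (m*n/n≡m q b) ⟩
      q                 ∎
    where
    open ≡-Reasoning
    remainders<b : d % b + q * b % b < b
    remainders<b = subst (_< b)
      (sym (trans (cong₂ _+_ (m<n⇒m%n≡m d<b) (m*n%n≡0 q b)) (+-identityʳ d))) d<b

  [d+q*b]%b≡d : ∀ d q → d < b → (d + q * b) % b ≡ d
  [d+q*b]%b≡d d q d<b = trans ([m+kn]%n≡m%n d q b) (m<n⇒m%n≡m d<b)

  s-digit-step : ∀ d q → d < b → s b (d + q * b) ≡ d + s b q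
  s-digit-step d q d<b = begin
      s b m                                  ≡⟨ s-unfold m ⟩
      m % b + digitSumAux b (pred m) (m / b) ≡⟨ cong₂ _+_ ([d+q*b]%b≡d d q d<b) (cong (digitSumAux b (pred m)) m/b≡q) ⟩
      d + digitSumAux b (pred m) q           ≡⟨ cong (d +_) (digitSumAux-fuel (pred m) q q q≤pred-m ≤-refl) ⟩
      d + s b q                              ∎
    where
    open ≡-Reasoning
    m = d + q * b
    m/b≡q : m / b ≡ q
    m/b≡q = [d+q*b]/b≡q d q d<b
    q≤pred-m : q ≤ pred m
    q≤pred-m = subst (_≤ pred m) m/b≡q (n/b≤pred-n m)

  s-digit : ∀ d → d < b → s b d ≡ d
  s-digit d d<b = begin
      s b d           ≡⟨ cong (s b) (sym (+-identityʳ d)) ⟩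
      s b (d + 0 * b) ≡⟨ s-digit-step d 0 d<b ⟩
      d + 0           ≡⟨ +-identityʳ d ⟩
      d               ∎
    where open ≡-Reasoning

  s-*b : ∀ q → s b (q * b) ≡ s b q
  s-*b q = s-digit-step 0 q (<-trans (s≤s z≤n) 1<b)

  s-b≡1 : s b b ≡ 1
  s-b≡1 = begin
      s b b       ≡⟨ cong (s b) (sym (*-identityˡ b)) ⟩
      s b (1 * b) ≡⟨ s-*b 1 ⟩
      s b 1       ≡⟨ s-digit 1 1<b ⟩
      1           ∎
    where open ≡-Reasoning

  s-b*b≡1 : s b (b * b) ≡ 1
  s-b*b≡1 = trans (s-*b b) s-b≡1

  ∤-last-digit : ∀ d q → 0 < d → d < b → ¬ (b ∣ d + q * b)
  ∤-last-digit d q 0<d d<b b∣m =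
    <⇒≢ 0<d (sym (trans (sym ([d+q*b]%b≡d d q d<b)) (n∣m⇒m%n≡0 _ b b∣m)))

antiNiven-of-s≡1 : ∀ b .{{_ : NonZero b}} m → 0 < m → s b m ≡ 1 → AntiNiven b m
antiNiven-of-s≡1 b m 0<m s≡1 = 0<m , trans (cong (gcd m) s≡1) (gcd-zeroʳ m)

antiNiven-of-s≡prime : ∀ p .{{_ : NonZero p}} → Prime p → ∀ m →
                       0 < m → ¬ (p ∣ m) → s p m ≡ p → AntiNiven p m
antiNiven-of-s≡prime p pp m 0<m p∤m s≡p = 0<m , trans (cong (gcd m) s≡p) gcd[m,p]≡1
  where
  gcd[m,p]≡1 : gcd m p ≡ 1
  gcd[m,p]≡1 with prime⇒irreducible pp (gcd[m,n]∣n m p)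
  ... | inj₁ gcd≡1 = gcd≡1
  ... | inj₂ gcd≡p = ⊥-elim (p∤m (subst (_∣ m) gcd≡p (gcd[m,n]∣m m p)))

antiNiven-two-digits : ∀ p .{{_ : NonZero p}} → Prime p → ∀ d q →
                       0 < d → d < p → d + s p q ≡ p → AntiNiven p (d + q * p)
antiNiven-two-digits p pp@(prime _) d q 0<d d<p digits≡p =
  antiNiven-of-s≡prime p pp (d + q * p) (≤-trans 0<d (m≤m+n d _))
    (∤-last-digit d q 0<d d<p) (trans (s-digit-step d q d<p) digits≡p)
  where open DigitSum p (nonTrivial⇒n>1 p)

low-term-expansion : ∀ k r →
  1 + (2 + k) * suc (k + r) ≡ suc r + suc k * (2 + (k + r))
low-term-expansion = solve-∀

square-term-expansion : ∀ c → 1 + (2 + suc c) * suc c ≡ (2 + c) * (2 + c)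
square-term-expansion = solve-∀

high-term-expansion : ∀ t r →
  1 + (2 + (suc (t + r) + suc t)) * suc (t + r) ≡ suc r + (2 + (t + r) + t) * (2 + (t + r))
high-term-expansion = solve-∀

high-index-bound : ∀ c t → 2 + (suc c + suc t) ≤ 2 * (2 + c) → t ≤ c
high-index-bound c t j≤2b = +-cancelˡ-≤ (4 + c) t c (subst₂ _≤_ (j≡ c t) (2b≡ c) j≤2b)
  where
  j≡ : ∀ c t → 2 + (suc c + suc t) ≡ 4 + c + t
  j≡ = solve-∀
  2b≡ : ∀ c → 2 * (2 + c) ≡ 4 + c + c
  2b≡ = solve-∀

module _ (c : ℕ) where
  open DigitSum (2 + c) (s≤s (s≤s z≤n))

  antiNiven-1 : AntiNiven (2 + c) 1
  antiNiven-1 = antiNiven-of-s≡1 (2 + c) 1 (s≤s z≤n) (s-digit 1 (s≤s (s≤s z≤n)))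

  antiNiven-b : AntiNiven (2 + c) (1 + 1 * suc c)
  antiNiven-b = subst (AntiNiven (2 + c)) (cong suc (sym (*-identityˡ (suc c))))
    (antiNiven-of-s≡1 (2 + c) (2 + c) (s≤s z≤n) s-b≡1)

  antiNiven-b² : AntiNiven (2 + c) (1 + (2 + suc c) * suc c)
  antiNiven-b² = subst (AntiNiven (2 + c)) (sym (square-term-expansion c))
    (antiNiven-of-s≡1 (2 + c) ((2 + c) * (2 + c)) (s≤s z≤n) s-b*b≡1)

module _ (k r : ℕ) (pp : Prime (2 + (k + r))) where
  open DigitSum (2 + (k + r)) (s≤s (s≤s z≤n))

  private
    r<b : suc r < 2 + (k + r)
    r<b = s≤s (s≤s (m≤n+m r k))

    k<b : suc k < 2 + (k + r)
    k<b = s≤s (s≤s (m≤m+n k r))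

    digits-sum-to-b : suc r + suc k ≡ 2 + (k + r)
    digits-sum-to-b = cong suc (trans (+-suc r k) (cong suc (+-comm r k)))

  antiNiven-low : AntiNiven (2 + (k + r)) (1 + (2 + k) * suc (k + r))
  antiNiven-low = subst (AntiNiven (2 + (k + r))) (sym (low-term-expansion k r))
    (antiNiven-two-digits _ pp (suc r) (suc k) (s≤s z≤n) r<b
      (trans (cong (suc r +_) (s-digit (suc k) k<b)) digits-sum-to-b))

  s[b+k]≡1+k : s (2 + (k + r)) (2 + (k + r) + k) ≡ suc k
  s[b+k]≡1+k = begin
      s b (b + k)     ≡⟨ cong (s b) (trans (+-comm b k) (cong (k +_) (sym (*-identityˡ b)))) ⟩
      s b (k + 1 * b) ≡⟨ s-digit-step k 1 (<-trans (n<1+n k) k<b) ⟩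
      k + s b 1       ≡⟨ cong (k +_) (s-digit 1 (s≤s (s≤s z≤n))) ⟩
      k + 1           ≡⟨ +-comm k 1 ⟩
      suc k           ∎
    where
    open ≡-Reasoning
    b = 2 + (k + r)

  antiNiven-high : AntiNiven (2 + (k + r)) (1 + (2 + (suc (k + r) + suc k)) * suc (k + r))
  antiNiven-high = subst (AntiNiven (2 + (k + r))) (sym (high-term-expansion k r))
    (antiNiven-two-digits _ pp (suc r) (2 + (k + r) + k) (s≤s z≤n) r<b
      (trans (cong (suc r +_) s[b+k]≡1+k) digits-sum-to-b))

antiNiven-term : ∀ c → Prime (2 + c) → ∀ j → j ≤ 2 * (2 + c) → AntiNiven (2 + c) (1 + j * suc c)
antiNiven-term c pp zero          _ = antiNiven-1 c
antiNiven-term c pp (suc zero)    _ = antiNiven-b c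
antiNiven-term c pp (suc (suc k)) j≤2b with k ≤? c
... | yes k≤c with r , refl ← m≤n⇒∃[o]m+o≡n k≤c = antiNiven-low k r pp
... | no k≰c with t , refl ← m≤n⇒∃[o]m+o≡n (≰⇒> k≰c) with t
...   | zero = subst (λ j → AntiNiven (2 + c) (1 + (2 + j) * suc c)) (sym (+-identityʳ (suc c)))
                 (antiNiven-b² c)
...   | suc t′ with r , refl ← m≤n⇒∃[o]m+o≡n (high-index-bound c t′ j≤2b) = antiNiven-high t′ r pp

theorem4p2 : (b : ℕ) → (bp : Prime b) → ¬ (2 ∣ b) →
    Σ ℕ (λ n → 0 < n × ((j : ℕ) → j ≤ 2 * b → AntiNiven b {{prime⇒nonZero bp}} (n + j * (b ∸ 1))))
theorem4p2 zero          bp _ = ⊥-elim (¬prime[0] bp)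
theorem4p2 (suc zero)    bp _ = ⊥-elim (¬prime[1] bp)
theorem4p2 (suc (suc c)) bp _ = 1 , s≤s z≤n , antiNiven-term c bp
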